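{- Let $(B,\cdot,\circ)$ be a skew left brace with associated solution $(B,\lambda,\rho)$. If $(B,\lambda,\rho)$ is right distributive, then (i) $\rho_y(x)=\bar y\circ(x\cdot y)$ for all $x,y\in B$, and (ii) $\rho_x$ is an automorphism of $(B,\cdot)$ for every $x\in B$.
   Context: A skew left brace is $(B,\cdot,\circ)$ with $(B,\cdot)$ and $(B,\circ)$ groups such that $a\circ(b\cdot c)=(a\circ b)\cdot a^{ -1}\cdot(a\circ c)$ for all $a,b,c$; $a^{ -1}$ and $\bar a$ denote inverses in $(B,\cdot)$ and $(B,\circ)$. The associated solution: $\lambda_a(b)=a^{ -1}\cdot(a\circ b)$, $\rho_b(a)=\overline{\lambda_a(b)}\circ a\circ b$. It is right distributive if $\rho_x\rho_y=\rho_{\rho_x(y)}\rho_x$ for all $x,y\in B$. -}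

module Defs where

open import Level using (Level; suc; _⊔_)
open import Relation.Binary.PropositionalEquality using (_≡_)
open import Algebra.Structures using (IsGroup)
open import Function.Definitions using (Bijective)
open import Data.Product using (_×_)

record SkewLeftBrace (ℓ : Level) : Set (suc ℓ) where
  infixl 7 _·_
  infixl 8 _∘_
  field
    B      : Set ℓ
    _·_    : B → B → B
    e      : B
    _⁻¹    : B → B
    _∘_    : B → B → B
    e∘     : B
    inv∘   : B → B
    isGroup·  : IsGroup _≡_ _·_ e _⁻¹
    isGroup∘  : IsGroup _≡_ _∘_ e∘ inv∘
    brace  : ∀ a b c → a ∘ (b · c) ≡ ((a ∘ b) · (a ⁻¹)) · (a ∘ c)

  λ′ : B → B → B
  λ′ a b = (a ⁻¹) · (a ∘ b)

  ρ : B → B → B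
  ρ b a = (inv∘ (λ′ a b) ∘ a) ∘ b

  RightDistributive : Set ℓ
  RightDistributive = ∀ x y z → ρ x (ρ y z) ≡ ρ (ρ x y) (ρ x z)

  IsAutomorphism· : (B → B) → Set ℓ
  IsAutomorphism· f = (∀ a b → f (a · b) ≡ f a · f b) × Bijective _≡_ _≡_ f

-- Right distributivity says ρ_z ρ_y = ρ_{ρ_z y} ρ_z, while the braid relation of the
-- solution gives ρ_z ρ_y = ρ_{ρ_z y} ρ_{λ_y z}. As every ρ_v is injective, ρ_{λ_y z} = ρ_z.
-- Since λ_x is bijective, y may be replaced by b with λ_x b = y, and then
-- ρ_b x = (λ_x b)‾ ∘ (x · λ_x b) = ȳ ∘ (x · y). The map a ↦ ȳ ∘ (a · y) is an automorphism
-- of (B,·) in every skew left brace, by the brace identity and ȳ ∘ y = 1.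
module Submission where

open import Defs
open import Level using (Level)
open import Algebra.Bundles using (Group)
import Algebra.Properties.Group as GroupProperties
open import Data.Product using (_×_; _,_)
open import Function.Definitions using (Injective; Surjective)
open import Function.Consequences.Propositional using (strictlySurjective⇒surjective)
open import Relation.Binary.PropositionalEquality
  using (_≡_; sym; trans; cong; cong₂; _≗_; module ≡-Reasoning)

module SkewLeftBraceProperties {ℓ} (S : SkewLeftBrace ℓ) where
  open SkewLeftBrace S
  open ≡-Reasoning

  private
    module · where
      group : Group ℓ ℓ
      group = record { isGroup = isGroup· }
      open Group group public
      open GroupProperties group public
    module ∘ where
      group : Group ℓ ℓ
      group = record { isGroup = isGroup∘ }
      open Group group public
      open GroupProperties group public

  e∘≡e : e∘ ≡ e
  e∘≡e = ·.identityʳ-unique e∘ e∘ e∘-idempotent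
    where
    e∘-idempotent : e∘ · e∘ ≡ e∘
    e∘-idempotent = begin
      e∘ · e∘                        ≡⟨ ∘.identityˡ (e∘ · e∘) ⟨
      e∘ ∘ (e∘ · e∘)                 ≡⟨ brace e∘ e∘ e∘ ⟩
      (e∘ ∘ e∘) · e∘ ⁻¹ · (e∘ ∘ e∘)  ≡⟨ cong₂ (λ u w → u · e∘ ⁻¹ · w) (∘.identityˡ e∘) (∘.identityˡ e∘) ⟩
      e∘ · e∘ ⁻¹ · e∘                ≡⟨ ·.//-rightDividesˡ e∘ e∘ ⟩
      e∘                             ∎

  ∘-identityˡ : ∀ b → e ∘ b ≡ b
  ∘-identityˡ b = trans (cong (_∘ b) (sym e∘≡e)) (∘.identityˡ b)

  ∘-inverseˡ : ∀ a → inv∘ a ∘ a ≡ e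
  ∘-inverseˡ a = trans (∘.inverseˡ a) e∘≡e

  ∘-inverseʳ : ∀ a → a ∘ inv∘ a ≡ e
  ∘-inverseʳ a = trans (∘.inverseʳ a) e∘≡e

  ∘≡·λ : ∀ a b → a ∘ b ≡ a · λ′ a b
  ∘≡·λ a b = sym (·.\\-leftDividesˡ a (a ∘ b))

  λ-identity : ∀ b → λ′ e b ≡ b
  λ-identity b = trans (cong₂ _·_ ·.ε⁻¹≈ε (∘-identityˡ b)) (·.identityˡ b)

  λ-homo : ∀ a b c → λ′ a (b · c) ≡ λ′ a b · λ′ a c
  λ-homo a b c = begin
    a ⁻¹ · (a ∘ (b · c))                  ≡⟨ cong (a ⁻¹ ·_) (brace a b c) ⟩
    a ⁻¹ · ((a ∘ b) · a ⁻¹ · (a ∘ c))     ≡⟨ cong (a ⁻¹ ·_) (·.assoc _ _ _) ⟩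
    a ⁻¹ · ((a ∘ b) · (a ⁻¹ · (a ∘ c)))   ≡⟨ ·.assoc _ _ _ ⟨
    a ⁻¹ · (a ∘ b) · (a ⁻¹ · (a ∘ c))     ∎

  λ-∘ : ∀ a b c → λ′ (a ∘ b) c ≡ λ′ a (λ′ b c)
  λ-∘ a b c = begin
    (a ∘ b) ⁻¹ · ((a ∘ b) ∘ c)                      ≡⟨ cong ((a ∘ b) ⁻¹ ·_) (∘.assoc a b c) ⟩
    (a ∘ b) ⁻¹ · (a ∘ (b ∘ c))                      ≡⟨ cong (λ t → (a ∘ b) ⁻¹ · (a ∘ t)) (∘≡·λ b c) ⟩
    (a ∘ b) ⁻¹ · (a ∘ (b · λ′ b c))                 ≡⟨ cong ((a ∘ b) ⁻¹ ·_) (brace a b (λ′ b c)) ⟩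
    (a ∘ b) ⁻¹ · ((a ∘ b) · a ⁻¹ · (a ∘ λ′ b c))    ≡⟨ cong ((a ∘ b) ⁻¹ ·_) (·.assoc _ _ _) ⟩
    (a ∘ b) ⁻¹ · ((a ∘ b) · (a ⁻¹ · (a ∘ λ′ b c)))  ≡⟨ ·.\\-leftDividesʳ (a ∘ b) _ ⟩
    a ⁻¹ · (a ∘ λ′ b c)                             ∎

  λ-inverse : ∀ a y → λ′ a (λ′ (inv∘ a) y) ≡ y
  λ-inverse a y = begin
    λ′ a (λ′ (inv∘ a) y)  ≡⟨ λ-∘ a (inv∘ a) y ⟨
    λ′ (a ∘ inv∘ a) y     ≡⟨ cong (λ t → λ′ t y) (∘-inverseʳ a) ⟩
    λ′ e y                ≡⟨ λ-identity y ⟩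
    y                     ∎

  λ-inv∘-self : ∀ s → λ′ (inv∘ s) s ≡ inv∘ s ⁻¹
  λ-inv∘-self s = trans (cong (inv∘ s ⁻¹ ·_) (∘-inverseˡ s)) (·.identityʳ _)

  λ∘ρ : ∀ x y → λ′ x y ∘ ρ y x ≡ x ∘ y
  λ∘ρ x y = trans (cong (λ′ x y ∘_) (∘.assoc _ x y)) (∘.\\-leftDividesˡ (λ′ x y) (x ∘ y))

  ρ-via-λ : ∀ b x → ρ b x ≡ inv∘ (λ′ x b) ∘ (x · λ′ x b)
  ρ-via-λ b x = trans (∘.assoc _ x b) (cong (inv∘ (λ′ x b) ∘_) (∘≡·λ x b))

  λ-ρ : ∀ x y z → λ′ x y ∘ λ′ (ρ y x) z ≡ λ′ x (y ∘ z)
  λ-ρ x y z = begin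
    λ′ x y ∘ λ′ (ρ y x) z                ≡⟨ ∘≡·λ _ _ ⟩
    λ′ x y · λ′ (λ′ x y) (λ′ (ρ y x) z)  ≡⟨ cong (λ′ x y ·_) (λ-∘ _ _ _) ⟨
    λ′ x y · λ′ (λ′ x y ∘ ρ y x) z       ≡⟨ cong (λ t → λ′ x y · λ′ t z) (λ∘ρ x y) ⟩
    λ′ x y · λ′ (x ∘ y) z                ≡⟨ cong (λ′ x y ·_) (λ-∘ x y z) ⟩
    λ′ x y · λ′ x (λ′ y z)               ≡⟨ λ-homo x y (λ′ y z) ⟨
    λ′ x (y · λ′ y z)                    ≡⟨ cong (λ′ x) (∘≡·λ y z) ⟨
    λ′ x (y ∘ z)                         ∎

  ρ-twice : ∀ x y z → ρ z (ρ y x) ≡ inv∘ (λ′ x (y ∘ z)) ∘ (x ∘ (y ∘ z))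
  ρ-twice x y z = begin
    (inv∘ p ∘ ((inv∘ q ∘ x) ∘ y)) ∘ z  ≡⟨ ∘.assoc _ _ z ⟩
    inv∘ p ∘ (((inv∘ q ∘ x) ∘ y) ∘ z)  ≡⟨ cong (inv∘ p ∘_) (trans (∘.assoc _ y z) (∘.assoc _ x _)) ⟩
    inv∘ p ∘ (inv∘ q ∘ (x ∘ (y ∘ z)))  ≡⟨ ∘.assoc _ _ _ ⟨
    (inv∘ p ∘ inv∘ q) ∘ (x ∘ (y ∘ z))  ≡⟨ cong (_∘ (x ∘ (y ∘ z))) (∘.⁻¹-anti-homo-∙ q p) ⟨
    inv∘ (q ∘ p) ∘ (x ∘ (y ∘ z))       ≡⟨ cong (λ t → inv∘ t ∘ (x ∘ (y ∘ z))) (λ-ρ x y z) ⟩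
    inv∘ (λ′ x (y ∘ z)) ∘ (x ∘ (y ∘ z)) ∎
    where
    p = λ′ (ρ y x) z
    q = λ′ x y

  ρ-braid : ∀ x y z → ρ z (ρ y x) ≡ ρ (ρ z y) (ρ (λ′ y z) x)
  ρ-braid x y z = begin
    ρ z (ρ y x)                                      ≡⟨ ρ-twice x y z ⟩
    inv∘ (λ′ x (y ∘ z)) ∘ (x ∘ (y ∘ z))              ≡⟨ cong (λ t → inv∘ (λ′ x t) ∘ (x ∘ t)) (λ∘ρ y z) ⟨
    inv∘ (λ′ x (w ∘ r)) ∘ (x ∘ (w ∘ r))              ≡⟨ ρ-twice x w r ⟨
    ρ r (ρ w x)                                      ∎
    where
    w = λ′ y z
    r = ρ z y

  -- ρ_v a = ū ∘ a ∘ v with u = λ_a v, and λ_{ū ∘ a} v = ū⁻¹ recovers u from the prefix ū ∘ a.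
  ρ-injective : ∀ v → Injective _≡_ _≡_ (ρ v)
  ρ-injective v {a} {b} ρa≡ρb =
    ∘.∙-cancelˡ (inv∘ (u a)) a b (trans prefix-≡ (cong (_∘ b) (sym inv∘u-≡)))
    where
    u : B → B
    u x = λ′ x v

    prefix-≡ : inv∘ (u a) ∘ a ≡ inv∘ (u b) ∘ b
    prefix-≡ = ∘.∙-cancelʳ v _ _ ρa≡ρb

    λ-prefix : ∀ x → λ′ (inv∘ (u x) ∘ x) v ≡ inv∘ (u x) ⁻¹
    λ-prefix x = trans (λ-∘ _ x v) (λ-inv∘-self (u x))

    inv∘u-≡ : inv∘ (u a) ≡ inv∘ (u b)
    inv∘u-≡ = ·.⁻¹-injective
      (trans (sym (λ-prefix a)) (trans (cong (λ c → λ′ c v) prefix-≡) (λ-prefix b)))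

  τ : B → B → B
  τ y a = inv∘ y ∘ (a · y)

  τ-homo : ∀ y a b → τ y (a · b) ≡ τ y a · τ y b
  τ-homo y a b = begin
    t ∘ (a · b · y)                    ≡⟨ cong (t ∘_) (·.assoc a b y) ⟩
    t ∘ (a · (b · y))                  ≡⟨ brace t a (b · y) ⟩
    (t ∘ a) · t ⁻¹ · (t ∘ (b · y))     ≡⟨ cong (_· (t ∘ (b · y))) τ-y-a ⟨
    t ∘ (a · y) · (t ∘ (b · y))        ∎
    where
    t = inv∘ y
    τ-y-a : t ∘ (a · y) ≡ (t ∘ a) · t ⁻¹
    τ-y-a = begin
      t ∘ (a · y)              ≡⟨ brace t a y ⟩
      (t ∘ a) · t ⁻¹ · (t ∘ y) ≡⟨ cong ((t ∘ a) · t ⁻¹ ·_) (∘-inverseˡ y) ⟩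
      (t ∘ a) · t ⁻¹ · e       ≡⟨ ·.identityʳ _ ⟩
      (t ∘ a) · t ⁻¹           ∎

  τ-injective : ∀ y → Injective _≡_ _≡_ (τ y)
  τ-injective y {a} {b} eq = ·.∙-cancelʳ y a b (∘.∙-cancelˡ (inv∘ y) _ _ eq)

  τ-surjective : ∀ y → Surjective _≡_ _≡_ (τ y)
  τ-surjective y = strictlySurjective⇒surjective λ a → (y ∘ a) · y ⁻¹ ,
    trans (cong (inv∘ y ∘_) (·.//-rightDividesˡ y (y ∘ a))) (∘.\\-leftDividesʳ y a)

  τ-isAutomorphism : ∀ y → IsAutomorphism· (τ y)
  τ-isAutomorphism y = τ-homo y , τ-injective y , τ-surjective y

  isAutomorphism-resp-≗ : ∀ {f g} → f ≗ g → IsAutomorphism· f → IsAutomorphism· g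
  isAutomorphism-resp-≗ {f} {g} f≗g (homo , injective , surjective) =
    homo′ , injective′ , surjective′
    where
    homo′ : ∀ a b → g (a · b) ≡ g a · g b
    homo′ a b = trans (sym (f≗g (a · b))) (trans (homo a b) (cong₂ _·_ (f≗g a) (f≗g b)))

    injective′ : Injective _≡_ _≡_ g
    injective′ {a} {b} ga≡gb = injective (trans (f≗g a) (trans ga≡gb (sym (f≗g b))))

    surjective′ : Surjective _≡_ _≡_ g
    surjective′ y with surjective y
    ... | a , fa≡y = a , λ {z} z≡a → trans (sym (f≗g z)) (fa≡y z≡a)

  module WithRightDistributivity (rightDistributive : RightDistributive) where

    ρ-λ-invariant : ∀ y z x → ρ (λ′ y z) x ≡ ρ z x
    ρ-λ-invariant y z x =
      ρ-injective (ρ z y) (trans (sym (ρ-braid x y z)) (rightDistributive z y x))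

    ρ≗τ : ∀ y → ρ y ≗ τ y
    ρ≗τ y x = begin
      ρ y x           ≡⟨ cong (λ t → ρ t x) (λ-inverse x y) ⟨
      ρ (λ′ x b) x    ≡⟨ ρ-λ-invariant x b x ⟩
      ρ b x           ≡⟨ ρ-via-λ b x ⟩
      τ (λ′ x b) x    ≡⟨ cong (λ t → τ t x) (λ-inverse x y) ⟩
      τ y x           ∎
      where
      b = λ′ (inv∘ x) y

lemma5p14 : {ℓ : Level} (S : SkewLeftBrace ℓ) →
    SkewLeftBrace.RightDistributive S →
    (∀ x y → SkewLeftBrace.ρ S y x ≡ SkewLeftBrace._∘_ S (SkewLeftBrace.inv∘ S y) (SkewLeftBrace._·_ S x y))
    × (∀ x → SkewLeftBrace.IsAutomorphism· S (SkewLeftBrace.ρ S x))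
lemma5p14 S rightDistributive =
  (λ x y → ρ≗τ y x) ,
  (λ x → isAutomorphism-resp-≗ (λ a → sym (ρ≗τ x a)) (τ-isAutomorphism x))
  where
  open SkewLeftBraceProperties S
  open WithRightDistributivity rightDistributive
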